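{- Consider the following static algorithm on a set system $(\mathcal{S},\mathcal{E})$ with costs $1/C\le c_s\le 1$, $n=|\mathcal{E}|$, every element contained in at least one set, and $0<\epsilon<1/2$. Initialize $L=\lceil\log_{1+\epsilon}(Cn)\rceil+1$, $w(e)=(1+\epsilon)^{ -L}$ and $\ell(e)=L$ for every element, and $\ell(s)=L$ for every set. For rounds $t=L,L-1,\dots,1$: let $\mathcal{S}^{(t)}_{slack}=\{s\in\mathcal{S}: W(s)<(1+\epsilon)^{ -1}c_s\}$ (with $W(s)=\sum_{e\in s}w(e)$ computed at the beginning of the round) and $\mathcal{E}^{(t)}_{slack}=\{e\in\mathcal{E}: e\notin s\text{ for all } s\in\mathcal{S}\setminus\mathcal{S}^{(t)}_{slack}\}$; decrease $\ell(s)$ by one for every $s\in\mathcal{S}^{(t)}_{slack}$; for every $e\in\mathcal{E}^{(t)}_{slack}$ multiply $w(e)$ by $(1+\epsilon)$ and decrease $\ell(e)$ by one. Then at the end of this algorithm, every element $e\in\mathcal{E}$ satisfies $\ell(e)=\max\{\ell(s): s\in\mathcal{S}, e\in s\}$ and $w(e)=(1+\epsilon)^{ -\ell(e)}$.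
   Formalization: The costs $c_s$ and the parameters $C$ and $\epsilon$ are rational numbers. -}

module Defs where

open import Data.Nat using (ℕ; zero; suc; _∸_)
open import Data.Fin using (Fin)
import Data.Fin as Fin
open import Data.Fin.Subset using (Subset; _∈_)
open import Data.Fin.Subset.Properties using (_∈?_)
open import Data.Bool using (Bool; true; false; if_then_else_; _∧_; _∨_; not)
open import Data.Integer using (+_)
open import Data.Rational using (ℚ; 0ℚ; 1ℚ; _+_; _*_; _<_; NonZero; >-nonZero; 1/_; _/_)
open import Data.Rational.Properties using (_<?_; +-mono-<; positive⁻¹)
open import Relation.Nullary.Decidable using (does)

ℕ→ℚ : ℕ → ℚ
ℕ→ℚ n = (+ n) / 1

_^ℚ_ : ℚ → ℕ → ℚ
p ^ℚ zero  = 1ℚ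
p ^ℚ suc k = p * (p ^ℚ k)

sumFin : ∀ {n} → (Fin n → ℚ) → ℚ
sumFin {zero}  f = 0ℚ
sumFin {suc n} f = f Fin.zero + sumFin (λ i → f (Fin.suc i))

allFinB : ∀ {m} → (Fin m → Bool) → Bool
allFinB {zero}  f = true
allFinB {suc m} f = f Fin.zero ∧ allFinB (λ i → f (Fin.suc i))

base-nonZero : ∀ ε → 0ℚ < ε → NonZero (1ℚ + ε)
base-nonZero ε ε>0 = >-nonZero (+-mono-< (positive⁻¹ 1ℚ) ε>0)

record State (m n : ℕ) : Set where
  constructor st
  field
    lvS : Fin m → ℕ
    lvE : Fin n → ℕ
    w   : Fin n → ℚ

module Algorithm {m n : ℕ} (S : Fin m → Subset n) (c : Fin m → ℚ)
                 (ε : ℚ) (ε>0 : 0ℚ < ε) where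

  binv : ℚ
  binv = (1/ (1ℚ + ε)) {{base-nonZero ε ε>0}}

  W : (Fin n → ℚ) → Fin m → ℚ
  W w s = sumFin (λ e → if does (e ∈? S s) then w e else 0ℚ)

  slackS : (Fin n → ℚ) → Fin m → Bool
  slackS w s = does (W w s <? (binv * c s))

  slackE : (Fin n → ℚ) → Fin n → Bool
  slackE w e = allFinB (λ s → not (does (e ∈? S s)) ∨ slackS w s)

  init : ℕ → State m n
  init L = st (λ _ → L) (λ _ → L) (λ _ → binv ^ℚ L)

  step : State m n → State m n
  step (st ls le w) =
    st (λ s → if slackS w s then ls s ∸ 1 else ls s)
       (λ e → if slackE w e then le e ∸ 1 else le e)
       (λ e → if slackE w e then (1ℚ + ε) * w e else w e)

  iter : ℕ → State m n → State m n
  iter zero    x = x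
  iter (suc k) x = iter k (step x)

  -- run rounds t = L, L-1, ..., 1
  run : ℕ → State m n
  run L = iter L (init L)

module Submission where

-- The algorithm keeps, before the round with index t (t = L, L-1, …, 1),
-- the following invariant (`RoundInvariant t`):
--   (a) every set has level ≥ t, and every set of level > t is tight
--       (not slack), so a set that is slack in this round has level exactly t;
--   (b) every element's level is the maximum level of the sets containing it;
--   (c) every element's weight is (1+ε)^{-ℓ(e)}.
-- It holds initially with t = L, since all levels equal L and every element
-- lies in some set.  One round turns `RoundInvariant (t+1)` into
-- `RoundInvariant t`: a slack element has only slack sets around it, all of
-- level t+1, so its level drops to t together with theirs and its weight is
-- multiplied by 1+ε; weights only grow, so tight sets stay tight.  After the L
-- rounds, `RoundInvariant 0` contains the theorem.  None of the quantitative
-- hypotheses (cost bounds, ε < ½, the choice of L) is needed for this part.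

open import Defs
open import Data.Nat using (ℕ; zero; suc; _∸_)
import Data.Nat as ℕ
import Data.Nat.Properties as ℕP
open import Data.Fin using (Fin; zero; suc)
open import Data.Fin.Subset using (Subset; _∈_)
open import Data.Fin.Subset.Properties using (_∈?_)
open import Data.Bool using (Bool; true; false; if_then_else_; _∨_; not)
open import Data.Product using (_×_; _,_; proj₁; proj₂; ∃-syntax)
open import Data.Empty using (⊥-elim)
open import Data.Rational
  using (ℚ; 0ℚ; 1ℚ; _+_; _*_; _<_; _≤_; 1/_; >-nonZero; ½; NonZero; positive; nonNegative)
import Data.Rational.Properties as ℚP
open import Relation.Nullary using (yes; no)
open import Relation.Nullary.Decidable using (does; dec-true; dec-false)
open import Relation.Binary.PropositionalEquality
  using (_≡_; _≢_; refl; sym; trans; cong; subst; module ≡-Reasoning)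

allFinB-true : ∀ {k} (f : Fin k → Bool) → allFinB f ≡ true → ∀ i → f i ≡ true
allFinB-true {suc k} f h i with f zero in f0
allFinB-true {suc k} f h zero    | true = f0
allFinB-true {suc k} f h (suc i) | true = allFinB-true (λ j → f (suc j)) h i

allFinB-false : ∀ {k} (f : Fin k → Bool) → allFinB f ≡ false → ∃[ i ] f i ≡ false
allFinB-false {suc k} f h with f zero in f0
... | true  = let (i , fi) = allFinB-false (λ j → f (suc j)) h in suc i , fi
... | false = zero , f0

true≢false : true ≢ false
true≢false ()

^ℚ-nonNeg : ∀ p → 0ℚ ≤ p → ∀ j → 0ℚ ≤ p ^ℚ j
^ℚ-nonNeg p p≥0 zero    = ℚP.nonNegative⁻¹ 1ℚ
^ℚ-nonNeg p p≥0 (suc j) = ℚP.nonNegative⁻¹ (p * p ^ℚ j)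
  {{ℚP.nonNeg*nonNeg⇒nonNeg p {{nonNegative p≥0}} (p ^ℚ j) {{nonNegative (^ℚ-nonNeg p p≥0 j)}}}}

*-cancel-^ℚ-inverse : ∀ p .{{_ : NonZero p}} j → p * ((1/ p) ^ℚ suc j) ≡ (1/ p) ^ℚ j
*-cancel-^ℚ-inverse p j = begin
  p * ((1/ p) * (1/ p) ^ℚ j)  ≡⟨ ℚP.*-assoc p (1/ p) _ ⟨
  (p * 1/ p) * (1/ p) ^ℚ j    ≡⟨ cong (_* (1/ p) ^ℚ j) (ℚP.*-inverseʳ p) ⟩
  1ℚ * (1/ p) ^ℚ j            ≡⟨ ℚP.*-identityˡ _ ⟩
  (1/ p) ^ℚ j                 ∎
  where open ≡-Reasoning

≤-scale : ∀ q x → 1ℚ ≤ q → 0ℚ ≤ x → x ≤ q * x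
≤-scale q x q≥1 x≥0 =
  subst (_≤ q * x) (ℚP.*-identityˡ x) (ℚP.*-monoʳ-≤-nonNeg x {{nonNegative x≥0}} q≥1)

sumFin-mono : ∀ {k} (f g : Fin k → ℚ) → (∀ i → f i ≤ g i) → sumFin f ≤ sumFin g
sumFin-mono {zero}  f g f≤g = ℚP.≤-refl
sumFin-mono {suc k} f g f≤g =
  ℚP.+-mono-≤ (f≤g zero) (sumFin-mono (λ i → f (suc i)) (λ i → g (suc i)) (λ i → f≤g (suc i)))

lower-≤ : ∀ b l → (if b then l ∸ 1 else l) ℕ.≤ l
lower-≤ true  l = ℕP.m∸n≤m l 1
lower-≤ false l = ℕP.≤-refl

module Analysis {m n : ℕ} (S : Fin m → Subset n) (c : Fin m → ℚ) (ε : ℚ) (ε>0 : 0ℚ < ε) where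
  open Algorithm S c ε ε>0
  open State

  1≤1+ε : 1ℚ ≤ 1ℚ + ε
  1≤1+ε = subst (_≤ 1ℚ + ε) (ℚP.+-identityʳ 1ℚ) (ℚP.+-monoʳ-≤ 1ℚ (ℚP.<⇒≤ ε>0))

  binv≥0 : 0ℚ ≤ binv
  binv≥0 = ℚP.nonNegative⁻¹ binv
    {{ℚP.pos⇒nonNeg binv {{ℚP.1/pos⇒pos (1ℚ + ε) {{positive (ℚP.<-≤-trans (ℚP.positive⁻¹ 1ℚ) 1≤1+ε)}}}}}}

  slackE⇒slackS : ∀ w e → slackE w e ≡ true → ∀ s → e ∈ S s → slackS w s ≡ true
  slackE⇒slackS w e slack s e∈s =
    subst (λ d → not d ∨ slackS w s ≡ true) (dec-true (e ∈? S s) e∈s)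
          (allFinB-true (λ s → not (does (e ∈? S s)) ∨ slackS w s) slack s)

  ¬slackE⇒tightS : ∀ w e → slackE w e ≡ false → ∃[ s ] (e ∈ S s × slackS w s ≡ false)
  ¬slackE⇒tightS w e tight with allFinB-false (λ s → not (does (e ∈? S s)) ∨ slackS w s) tight
  ... | s , tight-s with e ∈? S s
  ...   | yes e∈s = s , e∈s , tight-s
  ...   | no  _   = ⊥-elim (true≢false tight-s)

  W-mono : ∀ w w′ → (∀ e → w e ≤ w′ e) → ∀ s → W w s ≤ W w′ s
  W-mono w w′ w≤w′ s = sumFin-mono _ _ (λ e → summand (does (e ∈? S s)) e)
    where
    summand : ∀ b e → (if b then w e else 0ℚ) ≤ (if b then w′ e else 0ℚ)
    summand true  e = w≤w′ e
    summand false e = ℚP.≤-refl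

  tight-stable : ∀ w w′ → (∀ e → w e ≤ w′ e) → ∀ s → slackS w s ≡ false → slackS w′ s ≡ false
  tight-stable w w′ w≤w′ s tight = dec-false (W w′ s ℚP.<? (binv * c s)) λ W′<bc →
    true≢false (trans (sym (dec-true (W w s ℚP.<? (binv * c s))
                                     (ℚP.≤-<-trans (W-mono w w′ w≤w′ s) W′<bc))) tight)

  record RoundInvariant (t : ℕ) (x : State m n) : Set where
    field
      set-level-≥      : ∀ s → t ℕ.≤ lvS x s
      high-set-tight   : ∀ s → t ℕ.< lvS x s → slackS (w x) s ≡ false
      set-level-≤      : ∀ e s → e ∈ S s → lvS x s ℕ.≤ lvE x e
      set-level-attained : ∀ e → ∃[ s ] (e ∈ S s × lvS x s ≡ lvE x e)
      weight-level     : ∀ e → w x e ≡ binv ^ℚ lvE x e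

  module Round {t : ℕ} {x : State m n} (I : RoundInvariant (suc t) x) where
    open RoundInvariant I
    x′ : State m n
    x′ = step x

    slack-set-level : ∀ s → slackS (w x) s ≡ true → lvS x s ≡ suc t
    slack-set-level s slack = ℕP.≤-antisym
      (ℕP.≮⇒≥ λ t+1<ℓ → true≢false (trans (sym slack) (high-set-tight s t+1<ℓ)))
      (set-level-≥ s)

    -- A slack element has level exactly t+1, since all its sets do.
    slack-element-level : ∀ e → slackE (w x) e ≡ true → lvE x e ≡ suc t
    slack-element-level e slack =
      let (s , e∈s , ℓs≡ℓe) = set-level-attained e
      in trans (sym ℓs≡ℓe) (slack-set-level s (slackE⇒slackS (w x) e slack s e∈s))

    tight-witness : ∀ e → slackE (w x) e ≡ false
                  → ∃[ s ] (e ∈ S s × slackS (w x) s ≡ false × lvS x s ≡ lvE x e)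
    tight-witness e notSlack with set-level-attained e
    ... | s₀ , e∈s₀ , ℓs₀≡ℓe with slackS (w x) s₀ in slack₀
    ...   | false = s₀ , e∈s₀ , slack₀ , ℓs₀≡ℓe
    ...   | true  =
      let (s , e∈s , tight) = ¬slackE⇒tightS (w x) e notSlack
          ℓe≡t+1 = trans (sym ℓs₀≡ℓe) (slack-set-level s₀ slack₀)
      in s , e∈s , tight ,
         ℕP.≤-antisym (set-level-≤ e s e∈s) (subst (ℕ._≤ lvS x s) (sym ℓe≡t+1) (set-level-≥ s))

    -- Weights never decrease in a round (they are nonnegative powers of binv).
    weights-grow : ∀ e → w x e ≤ w x′ e
    weights-grow e with slackE (w x) e
    ... | true  = ≤-scale (1ℚ + ε) (w x e) 1≤1+ε
                    (subst (0ℚ ≤_) (sym (weight-level e)) (^ℚ-nonNeg binv binv≥0 (lvE x e)))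
    ... | false = ℚP.≤-refl

    set-level-≥′ : ∀ s → t ℕ.≤ lvS x′ s
    set-level-≥′ s with slackS (w x) s in slack
    ... | true  = subst (λ ℓ → t ℕ.≤ ℓ ∸ 1) (sym (slack-set-level s slack)) ℕP.≤-refl
    ... | false = ℕP.<⇒≤ (set-level-≥ s)

    high-set-tight′ : ∀ s → t ℕ.< lvS x′ s → slackS (w x′) s ≡ false
    high-set-tight′ s t<ℓ′ with slackS (w x) s in slack
    ... | true  = ⊥-elim (ℕP.<-irrefl refl (subst (λ ℓ → t ℕ.< ℓ ∸ 1) (slack-set-level s slack) t<ℓ′))
    ... | false = tight-stable (w x) (w x′) weights-grow s slack

    set-level-≤′ : ∀ e s → e ∈ S s → lvS x′ s ℕ.≤ lvE x′ e
    set-level-≤′ e s e∈s with slackE (w x) e in slack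
    ... | true rewrite slackE⇒slackS (w x) e slack s e∈s = ℕP.∸-monoˡ-≤ 1 (set-level-≤ e s e∈s)
    ... | false = ℕP.≤-trans (lower-≤ (slackS (w x) s) (lvS x s)) (set-level-≤ e s e∈s)

    set-level-attained′ : ∀ e → ∃[ s ] (e ∈ S s × lvS x′ s ≡ lvE x′ e)
    set-level-attained′ e with slackE (w x) e in slack
    ... | true  = let (s , e∈s , ℓs≡ℓe) = set-level-attained e in
      s , e∈s , subst (λ b → (if b then lvS x s ∸ 1 else lvS x s) ≡ lvE x e ∸ 1)
                      (sym (slackE⇒slackS (w x) e slack s e∈s)) (cong (_∸ 1) ℓs≡ℓe)
    ... | false = let (s , e∈s , tight , ℓs≡ℓe) = tight-witness e slack in
      s , e∈s , subst (λ b → (if b then lvS x s ∸ 1 else lvS x s) ≡ lvE x e) (sym tight) ℓs≡ℓe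

    weight-level′ : ∀ e → w x′ e ≡ binv ^ℚ lvE x′ e
    weight-level′ e with slackE (w x) e in slack
    ... | false = weight-level e
    ... | true  = begin
      (1ℚ + ε) * w x e              ≡⟨ cong ((1ℚ + ε) *_) (weight-level e) ⟩
      (1ℚ + ε) * binv ^ℚ lvE x e    ≡⟨ cong (λ ℓ → (1ℚ + ε) * binv ^ℚ ℓ) (slack-element-level e slack) ⟩
      (1ℚ + ε) * binv ^ℚ suc t      ≡⟨ *-cancel-^ℚ-inverse (1ℚ + ε) {{base-nonZero ε ε>0}} t ⟩
      binv ^ℚ t                     ≡⟨ cong (λ ℓ → binv ^ℚ (ℓ ∸ 1)) (slack-element-level e slack) ⟨
      binv ^ℚ (lvE x e ∸ 1)         ∎
      where open ≡-Reasoning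

  step-preserves : ∀ {t x} → RoundInvariant (suc t) x → RoundInvariant t (step x)
  step-preserves I = record
    { set-level-≥        = set-level-≥′
    ; high-set-tight     = high-set-tight′
    ; set-level-≤        = set-level-≤′
    ; set-level-attained = set-level-attained′
    ; weight-level       = weight-level′
    }
    where open Round I

  iter-preserves : ∀ i {t} x → RoundInvariant (i ℕ.+ t) x → RoundInvariant t (iter i x)
  iter-preserves zero    x I = I
  iter-preserves (suc i) x I = iter-preserves i (step x) (step-preserves I)

  init-invariant : (∀ e → ∃[ s ] (e ∈ S s)) → ∀ L → RoundInvariant L (init L)
  init-invariant covered L = record
    { set-level-≥        = λ s → ℕP.≤-refl
    ; high-set-tight     = λ s L<L → ⊥-elim (ℕP.<-irrefl refl L<L)
    ; set-level-≤        = λ e s e∈s → ℕP.≤-refl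
    ; set-level-attained = λ e → proj₁ (covered e) , proj₂ (covered e) , refl
    ; weight-level       = λ e → refl
    }

  run-invariant : (∀ e → ∃[ s ] (e ∈ S s)) → ∀ L → RoundInvariant 0 (run L)
  run-invariant covered L = iter-preserves L (init L)
    (subst (λ t → RoundInvariant t (init L)) (sym (ℕP.+-identityʳ L)) (init-invariant covered L))

claimA1 : (m n : ℕ) (S : Fin m → Subset n) (c : Fin m → ℚ) (C ε : ℚ)
          (C>0 : 0ℚ < C)
          → (∀ s → (1/ C) {{>-nonZero C>0}} ≤ c s)
          → (∀ s → c s ≤ 1ℚ)
          → (∀ e → ∃[ s ] (e ∈ S s))
          → (ε>0 : 0ℚ < ε) → ε < ½
          → (L k : ℕ)
          -- k = ⌈ log_{1+ε} (C n) ⌉ : the least k with C n ≤ (1+ε)^k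
          → C * ℕ→ℚ n ≤ (1ℚ + ε) ^ℚ k
          → (∀ j → j ℕ.< k → (1ℚ + ε) ^ℚ j < C * ℕ→ℚ n)
          → L ≡ suc k
          → let open Algorithm S c ε ε>0
                fin = run L
            in ∀ e → ((∀ s → e ∈ S s → State.lvS fin s ℕ.≤ State.lvE fin e)
                      × (∃[ s ] (e ∈ S s × State.lvS fin s ≡ State.lvE fin e)))
                     × State.w fin e ≡ binv ^ℚ State.lvE fin e
claimA1 m n S c C ε C>0 _ _ covered ε>0 _ L _ _ _ _ e =
  (set-level-≤ e , set-level-attained e) , weight-level e
  where open Analysis.RoundInvariant (Analysis.run-invariant S c ε ε>0 covered L)
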